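{- The group $\Gamma_0(8)$ is generated by the following two types of matrices: \[ u(s) := \begin{pmatrix} 1 & 0 \\ 8s & 1\end{pmatrix} \ (s \in {\mathbb Z}), \quad v(a) := \begin{pmatrix} a & 1\\ a^2-1 & a \end{pmatrix} \ (a = \pm 1, \pm 3). \] -}

module Defs where

open import Data.Integer using (ℤ; _+_; _*_; -_; _-_; +_; -[1+_])
open import Data.Integer.Divisibility using (_∣_)
open import Relation.Binary.PropositionalEquality using (_≡_)
open import Data.Product using (_×_)

record M2 : Set where
  constructor mat
  field
    a b c d : ℤ
open M2 public

infixl 7 _·_
_·_ : M2 → M2 → M2
mat a₁ b₁ c₁ d₁ · mat a₂ b₂ c₂ d₂ =
  mat (a₁ * a₂ + b₁ * c₂) (a₁ * b₂ + b₁ * d₂)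
      (c₁ * a₂ + d₁ * c₂) (c₁ * b₂ + d₁ * d₂)

I₂ : M2
I₂ = mat (+ 1) (+ 0) (+ 0) (+ 1)

det : M2 → ℤ
det (mat a b c d) = a * d - b * c

-- adjugate; this is the inverse of any matrix of determinant 1
adj : M2 → M2
adj (mat a b c d) = mat d (- b) (- c) a

InΓ₀8 : M2 → Set
InΓ₀8 γ = (det γ ≡ + 1) × ((+ 8) ∣ c γ)

u : ℤ → M2
u s = mat (+ 1) (+ 0) (+ 8 * s) (+ 1)

v : ℤ → M2
v x = mat x (+ 1) (x * x - + 1) x

data Gen : M2 → Set where
  gen-u  : (s : ℤ) → Gen (u s)
  gen-v1 : Gen (v (+ 1))
  gen-v-1 : Gen (v (-[1+ 0 ]))
  gen-v3 : Gen (v (+ 3))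
  gen-v-3 : Gen (v (-[1+ 2 ]))

data Generated : M2 → Set where
  g-id  : Generated I₂
  g-mul : ∀ {g m} → Gen g → Generated m → Generated (g · m)
  g-inv : ∀ {g m} → Gen g → Generated m → Generated (adj g · m)

{-# OPTIONS --safe #-}
-- The generators lie in Γ₀(8), which is closed under products and adjugates (the
-- inverses in SL₂(ℤ)); hence everything generated lies in Γ₀(8).
--
-- Conversely let γ = (a b; c d) ∈ Γ₀(8) with c ≠ 0. As ad - bc = 1 and c is even, a is
-- odd, so 8 ∣ c forces |c| ∉ {2|a|, 4|a|}. Left multiplication by v(1)^±1 turns a into
-- a ± c, by v(3)^±1 into 3a ± c, and by u(1)^±1 turns c into c ± 8a keeping a. For the
-- right sign the new entry has absolute value ||a| - |c||, |3|a| - |c|| or ||c| - 8|a||,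
-- which is below |a|, |a| or |c| when |c| < 2|a|, 2|a| < |c| < 4|a| or 4|a| < |c|
-- respectively. So (|a|, |c|) decreases lexicographically until c = 0, and then
-- γ = ±(1 b; 0 1), which is v(1)^b or v(-1) v(1)^(1-b).
module Submission where

open import Defs
open import Data.Integer as ℤ using (ℤ; +_; -[1+_]; _+_; _*_; -_; _-_; ∣_∣; _⊖_)
import Data.Integer.Properties as ℤP
open import Data.Integer.Divisibility using (_∣_)
import Data.Integer.Divisibility.Signed as ℤS
open import Data.Integer.Tactic.RingSolver using (solve-∀)
open import Data.Nat as ℕ using (suc; _<_)
open import Data.Nat.Induction using (<-wellFounded)
import Data.Nat.Properties as ℕP
import Data.Nat.Divisibility as ℕD
open import Data.Empty using (⊥-elim)
open import Data.Product using (∃-syntax; _×_; _,_; proj₁; proj₂)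
open import Data.Product.Relation.Binary.Lex.Strict using (×-Lex; ×-wellFounded)
open import Data.Sum as Sum using (_⊎_; inj₁; inj₂)
open import Function using (_on_; _∘_)
open import Function.Bundles using (_⇔_; mk⇔)
open import Induction.WellFounded using (WellFounded; Acc; acc)
import Relation.Binary.Construct.On as On
open import Relation.Binary.Definitions using (tri<; tri≈; tri>)
open import Relation.Binary.PropositionalEquality
open import Relation.Nullary using (¬_; yes; no)

m<o+n⇒m∸n<o : ∀ {m n o} → n ℕ.≤ m → m < o ℕ.+ n → m ℕ.∸ n < o
m<o+n⇒m∸n<o {m} {n} {o} n≤m m<o+n =
  ℕP.+-cancelʳ-< n (m ℕ.∸ n) o (subst (_< o ℕ.+ n) (sym (ℕP.m∸n+n≡m n≤m)) m<o+n)

∣m-n∣<o : ∀ {m n o} → m < o ℕ.+ n → n < o ℕ.+ m → ℕ.∣ m - n ∣ < o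
∣m-n∣<o {m} {n} {o} m<o+n n<o+m with ℕP.≤-total m n
... | inj₁ m≤n = subst (_< o) (sym (ℕP.m≤n⇒∣m-n∣≡n∸m m≤n)) (m<o+n⇒m∸n<o m≤n n<o+m)
... | inj₂ n≤m = subst (_< o) (sym (ℕP.m≤n⇒∣n-m∣≡n∸m n≤m)) (m<o+n⇒m∸n<o n≤m m<o+n)

8∣2*m⇒2∣m : ∀ {m} → 8 ℕD.∣ 2 ℕ.* m → 2 ℕD.∣ m
8∣2*m⇒2∣m 8∣2m = ℕD.∣-trans (ℕD.divides 2 refl) (ℕD.*-cancelˡ-∣ {m = 4} 2 8∣2m)

8∣4*m⇒2∣m : ∀ {m} → 8 ℕD.∣ 4 ℕ.* m → 2 ℕD.∣ m
8∣4*m⇒2∣m = ℕD.*-cancelˡ-∣ {m = 2} 4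

odd-descent : ∀ {m n} → ¬ 2 ℕD.∣ m → 8 ℕD.∣ n → 0 < n →
              ℕ.∣ m - n ∣ < m ⊎ ℕ.∣ 3 ℕ.* m - n ∣ < m ⊎ ℕ.∣ n - 8 ℕ.* m ∣ < n
odd-descent {m} {n} m-odd 8∣n 0<n with ℕP.<-cmp n (2 ℕ.* m)
... | tri< n<2m _ _ =
  inj₁ (∣m-n∣<o (ℕP.m<m+n m 0<n) (subst (n <_) (cong (m ℕ.+_) (ℕP.+-identityʳ m)) n<2m))
... | tri≈ _ refl _ = ⊥-elim (m-odd (8∣2*m⇒2∣m 8∣n))
... | tri> _ _ 2m<n with ℕP.<-cmp n (4 ℕ.* m)
...   | tri< n<4m _ _ = inj₂ (inj₁ (∣m-n∣<o (ℕP.+-monoʳ-< m 2m<n) n<4m))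
...   | tri≈ _ refl _ = ⊥-elim (m-odd (8∣4*m⇒2∣m 8∣n))
...   | tri> _ _ 4m<n =
  inj₂ (inj₂ (∣m-n∣<o (ℕP.m<m+n n (ℕP.*-monoʳ-< 8 0<m)) 8m<n+n))
  where
  0<m : 0 < m
  0<m = ℕP.n≢0⇒n>0 λ { refl → m-odd (2 ℕD.∣0) }
  8m<n+n : 8 ℕ.* m < n ℕ.+ n
  8m<n+n = subst (_< n ℕ.+ n) (sym (ℕP.*-distribʳ-+ m 4 4)) (ℕP.+-mono-< 4m<n 4m<n)

∣m⊖n∣≡∣m-n∣ : ∀ m n → ∣ m ⊖ n ∣ ≡ ℕ.∣ m - n ∣
∣m⊖n∣≡∣m-n∣ m n with ℕP.≤-total m n
... | inj₁ m≤n = trans (ℤP.∣⊖∣-≤ m≤n) (sym (ℕP.m≤n⇒∣m-n∣≡n∸m m≤n))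
... | inj₂ n≤m =
  trans (ℤP.∣m⊖n∣≡∣n⊖m∣ m n) (trans (ℤP.∣⊖∣-≤ n≤m) (sym (ℕP.m≤n⇒∣n-m∣≡n∸m n≤m)))

∣x+y∣⊎∣x-y∣≡∣∣x∣-∣y∣∣ : ∀ x y →
  ∣ x + y ∣ ≡ ℕ.∣ ∣ x ∣ - ∣ y ∣ ∣ ⊎ ∣ x - y ∣ ≡ ℕ.∣ ∣ x ∣ - ∣ y ∣ ∣
∣x+y∣⊎∣x-y∣≡∣∣x∣-∣y∣∣ (+ m)    (+ n)    =
  inj₂ (trans (cong ∣_∣ (ℤP.m-n≡m⊖n m n)) (∣m⊖n∣≡∣m-n∣ m n))
∣x+y∣⊎∣x-y∣≡∣∣x∣-∣y∣∣ (+ m)    -[1+ n ] = inj₁ (∣m⊖n∣≡∣m-n∣ m (suc n))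
∣x+y∣⊎∣x-y∣≡∣∣x∣-∣y∣∣ -[1+ m ] (+ n)    =
  inj₁ (trans (∣m⊖n∣≡∣m-n∣ n (suc m)) (ℕP.∣-∣-comm n (suc m)))
∣x+y∣⊎∣x-y∣≡∣∣x∣-∣y∣∣ -[1+ m ] -[1+ n ] =
  inj₂ (trans (∣m⊖n∣≡∣m-n∣ (suc n) (suc m)) (ℕP.∣-∣-comm (suc n) (suc m)))

∣x+y∣<⊎∣x-y∣< : ∀ x y {o} → ℕ.∣ ∣ x ∣ - ∣ y ∣ ∣ < o → ∣ x + y ∣ < o ⊎ ∣ x - y ∣ < o
∣x+y∣<⊎∣x-y∣< x y {o} d<o = Sum.map bounded bounded (∣x+y∣⊎∣x-y∣≡∣∣x∣-∣y∣∣ x y)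
  where
  bounded : ∀ {k} → k ≡ ℕ.∣ ∣ x ∣ - ∣ y ∣ ∣ → k < o
  bounded k≡d = subst (_< o) (sym k≡d) d<o

∣i∣≡1⇒i≡±1 : ∀ {i} → ∣ i ∣ ≡ 1 → i ≡ + 1 ⊎ i ≡ - + 1
∣i∣≡1⇒i≡±1 {+ 1}      _ = inj₁ refl
∣i∣≡1⇒i≡±1 { -[1+ 0 ]} _ = inj₂ refl
∣i∣≡1⇒i≡±1 {+ 0}      ()
∣i∣≡1⇒i≡±1 {+ suc (suc _)} ()
∣i∣≡1⇒i≡±1 { -[1+ suc _ ]} ()

i*j≡1⇒i≡j≡±1 : ∀ i j → i * j ≡ + 1 → (i ≡ + 1 × j ≡ + 1) ⊎ (i ≡ - + 1 × j ≡ - + 1)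
i*j≡1⇒i≡j≡±1 i j ij≡1
  with ∣i∣≡1⇒i≡±1 {i} (ℕP.m*n≡1⇒m≡1 ∣ i ∣ ∣ j ∣ (trans (sym (ℤP.abs-* i j)) (cong ∣_∣ ij≡1)))
... | inj₁ refl = inj₁ (refl , trans (sym (ℤP.*-identityˡ j)) ij≡1)
... | inj₂ refl =
  inj₂ (refl , trans (sym (ℤP.neg-involutive j)) (cong -_ (trans (sym (ℤP.-1*i≡-i j)) ij≡1)))

≡-mat : ∀ {a₁ b₁ c₁ d₁ a₂ b₂ c₂ d₂} →
        a₁ ≡ a₂ → b₁ ≡ b₂ → c₁ ≡ c₂ → d₁ ≡ d₂ → mat a₁ b₁ c₁ d₁ ≡ mat a₂ b₂ c₂ d₂
≡-mat refl refl refl refl = refl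

row·col-assoc : ∀ x y p q r s z w →
  (x * p + y * r) * z + (x * q + y * s) * w ≡ x * (p * z + q * w) + y * (r * z + s * w)
row·col-assoc = solve-∀

·-assoc : ∀ X Y Z → (X · Y) · Z ≡ X · (Y · Z)
·-assoc X (mat p q r s) Z =
  ≡-mat (row·col-assoc (a X) (b X) p q r s (a Z) (c Z)) (row·col-assoc (a X) (b X) p q r s (b Z) (d Z))
        (row·col-assoc (c X) (d X) p q r s (a Z) (c Z)) (row·col-assoc (c X) (d X) p q r s (b Z) (d Z))

·-identityˡ : ∀ X → I₂ · X ≡ X
·-identityˡ X = ≡-mat (top (a X) (c X)) (top (b X) (d X)) (bottom (a X) (c X)) (bottom (b X) (d X))
  where
  top : ∀ x y → + 1 * x + + 0 * y ≡ x
  top = solve-∀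
  bottom : ∀ x y → + 0 * x + + 1 * y ≡ y
  bottom = solve-∀

diag : ℤ → M2
diag x = mat x (+ 0) (+ 0) x

det-· : ∀ X Y → det (X · Y) ≡ det X * det Y
det-· (mat p q r s) (mat p′ q′ r′ s′) = ring-identity p q r s p′ q′ r′ s′
  where
  ring-identity : ∀ p q r s p′ q′ r′ s′ →
          (p * p′ + q * r′) * (r * q′ + s * s′) - (p * q′ + q * s′) * (r * p′ + s * r′)
          ≡ (p * s - q * r) * (p′ * s′ - q′ * r′)
  ring-identity = solve-∀

det-adj : ∀ X → det (adj X) ≡ det X
det-adj (mat p q r s) = ring-identity p q r s
  where
  ring-identity : ∀ p q r s → s * p - - q * - r ≡ p * s - q * r
  ring-identity = solve-∀

adj-involutive : ∀ X → adj (adj X) ≡ X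
adj-involutive (mat p q r s) = ≡-mat refl (ℤP.neg-involutive q) (ℤP.neg-involutive r) refl

·-adj : ∀ X → X · adj X ≡ diag (det X)
·-adj (mat p q r s) = ≡-mat (diagonal p q r s) (off-diagonal p q) (off-diagonal′ r s) (diagonal′ p q r s)
  where
  diagonal : ∀ p q r s → p * s + q * - r ≡ p * s - q * r
  diagonal = solve-∀
  diagonal′ : ∀ p q r s → r * - q + s * p ≡ p * s - q * r
  diagonal′ = solve-∀
  off-diagonal : ∀ x y → x * - y + y * x ≡ + 0
  off-diagonal = solve-∀
  off-diagonal′ : ∀ x y → x * y + y * - x ≡ + 0
  off-diagonal′ = solve-∀

adj-· : ∀ X → adj X · X ≡ diag (det X)
adj-· X = begin
  adj X · X              ≡⟨ cong (adj X ·_) (adj-involutive X) ⟨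
  adj X · adj (adj X)    ≡⟨ ·-adj (adj X) ⟩
  diag (det (adj X))     ≡⟨ cong diag (det-adj X) ⟩
  diag (det X)           ∎
  where open ≡-Reasoning

module _ (g : M2) (det≡1 : det g ≡ + 1) where

  adj-inverseˡ : adj g · g ≡ I₂
  adj-inverseˡ = trans (adj-· g) (cong diag det≡1)

  adj-inverseʳ : g · adj g ≡ I₂
  adj-inverseʳ = trans (·-adj g) (cong diag det≡1)

  adj-cancelˡ : ∀ γ → adj g · (g · γ) ≡ γ
  adj-cancelˡ γ = begin
    adj g · (g · γ)  ≡⟨ ·-assoc (adj g) g γ ⟨
    (adj g · g) · γ  ≡⟨ cong (_· γ) adj-inverseˡ ⟩
    I₂ · γ           ≡⟨ ·-identityˡ γ ⟩
    γ                ∎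
    where open ≡-Reasoning

  adj-cancelʳ : ∀ γ → g · (adj g · γ) ≡ γ
  adj-cancelʳ γ = begin
    g · (adj g · γ)  ≡⟨ ·-assoc g (adj g) γ ⟨
    (g · adj g) · γ  ≡⟨ cong (_· γ) adj-inverseʳ ⟩
    I₂ · γ           ≡⟨ ·-identityˡ γ ⟩
    γ                ∎
    where open ≡-Reasoning

InΓ₀ : ℤ → M2 → Set
InΓ₀ N γ = det γ ≡ + 1 × N ∣ c γ

Γ₀-I₂ : ∀ N → InΓ₀ N I₂
Γ₀-I₂ N = refl , ∣ N ∣ ℕD.∣0

Γ₀-· : ∀ N X Y → InΓ₀ N X → InΓ₀ N Y → InΓ₀ N (X · Y)
Γ₀-· N X Y (detX≡1 , N∣cX) (detY≡1 , N∣cY) =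
  trans (det-· X Y) (cong₂ _*_ detX≡1 detY≡1) ,
  ℤS.∣⇒∣ᵤ {N} {c X * a Y + d X * c Y}
    (ℤS.∣m∣n⇒∣m+n (ℤS.∣m⇒∣m*n (a Y) (signed {c X} N∣cX)) (ℤS.∣n⇒∣m*n (d X) (signed {c Y} N∣cY)))
  where
  signed : ∀ {i} → N ∣ i → N ℤS.∣ i
  signed {i} = ℤS.∣ᵤ⇒∣ {N} {i}

Γ₀-adj : ∀ N X → InΓ₀ N X → InΓ₀ N (adj X)
Γ₀-adj N X (detX≡1 , N∣cX) =
  trans (det-adj X) detX≡1 , subst (ℕD._∣_ ∣ N ∣) (sym (ℤP.∣-i∣≡∣i∣ (c X))) N∣cX

det≡1⇒∣a⇒∣c⇒∣1 : ∀ k γ → det γ ≡ + 1 → k ∣ a γ → k ∣ c γ → k ∣ + 1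
det≡1⇒∣a⇒∣c⇒∣1 k γ det≡1 k∣a k∣c = ℤS.∣⇒∣ᵤ {k} {+ 1} (subst (k ℤS.∣_) det≡1
  (ℤS.∣m∣n⇒∣m-n (ℤS.∣m⇒∣m*n (d γ) (ℤS.∣ᵤ⇒∣ {k} {a γ} k∣a)) (ℤS.∣n⇒∣m*n (b γ) (ℤS.∣ᵤ⇒∣ {k} {c γ} k∣c))))

Γ₀8⇒a-odd : ∀ γ → InΓ₀8 γ → ¬ 2 ℕD.∣ ∣ a γ ∣
Γ₀8⇒a-odd γ (det≡1 , 8∣c) 2∣a
  with ℕD.∣1⇒≡1 (det≡1⇒∣a⇒∣c⇒∣1 (+ 2) γ det≡1 2∣a (ℕD.∣-trans (ℕD.divides 4 refl) 8∣c))
... | ()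

Gen⊆Γ₀8 : ∀ {g} → Gen g → InΓ₀8 g
Gen⊆Γ₀8 (gen-u s) = refl , subst (ℕD._∣_ 8) (sym (ℤP.abs-* (+ 8) s)) (ℕD.m∣m*n ∣ s ∣)
Gen⊆Γ₀8 gen-v1    = refl , 8 ℕD.∣0
Gen⊆Γ₀8 gen-v-1   = refl , 8 ℕD.∣0
Gen⊆Γ₀8 gen-v3    = refl , ℕD.∣-refl
Gen⊆Γ₀8 gen-v-3   = refl , ℕD.∣-refl

Generated⇒Γ₀8 : ∀ {γ} → Generated γ → InΓ₀8 γ
Generated⇒Γ₀8 g-id                  = Γ₀-I₂ (+ 8)
Generated⇒Γ₀8 (g-mul {g} {m} g∈ m∈) = Γ₀-· (+ 8) g m (Gen⊆Γ₀8 g∈) (Generated⇒Γ₀8 m∈)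
Generated⇒Γ₀8 (g-inv {g} {m} g∈ m∈) = Γ₀-· (+ 8) (adj g) m (Γ₀-adj (+ 8) g (Gen⊆Γ₀8 g∈)) (Generated⇒Γ₀8 m∈)

Generated-cancelˡ : ∀ g γ → Gen g → Generated (g · γ) → Generated γ
Generated-cancelˡ g γ g∈ gγ∈ = subst Generated (adj-cancelˡ g (proj₁ (Gen⊆Γ₀8 g∈)) γ) (g-inv g∈ gγ∈)

Generated-adj-cancelˡ : ∀ g γ → Gen g → Generated (adj g · γ) → Generated γ
Generated-adj-cancelˡ g γ g∈ gγ∈ = subst Generated (adj-cancelʳ g (proj₁ (Gen⊆Γ₀8 g∈)) γ) (g-mul g∈ gγ∈)

T^_ : ℤ → M2
T^ x = mat (+ 1) x (+ 0) (+ 1)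

v1·T^ : ∀ x → v (+ 1) · T^ x ≡ T^ (+ 1 + x)
v1·T^ x = ≡-mat refl (b-entry x) refl refl
  where
  b-entry : ∀ x → + 1 * x + + 1 * + 1 ≡ + 1 + x
  b-entry = solve-∀

adj-v1·T^ : ∀ x → adj (v (+ 1)) · T^ x ≡ T^ (- + 1 + x)
adj-v1·T^ x = ≡-mat refl (b-entry x) refl refl
  where
  b-entry : ∀ x → + 1 * x + - + 1 * + 1 ≡ - + 1 + x
  b-entry = solve-∀

v-1·T^ : ∀ x → v (- + 1) · T^ (+ 1 - x) ≡ mat (- + 1) x (+ 0) (- + 1)
v-1·T^ x = ≡-mat refl (b-entry x) refl refl
  where
  b-entry : ∀ x → - + 1 * (+ 1 - x) + + 1 * + 1 ≡ x
  b-entry = solve-∀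

T^-generated : ∀ x → Generated (T^ x)
T^-generated (+ 0)        = g-id
T^-generated (+ suc n)    = subst Generated (v1·T^ (+ n)) (g-mul gen-v1 (T^-generated (+ n)))
T^-generated -[1+ 0 ]     = subst Generated (adj-v1·T^ (+ 0)) (g-inv gen-v1 g-id)
T^-generated -[1+ suc n ] = subst Generated (adj-v1·T^ -[1+ n ]) (g-inv gen-v1 (T^-generated -[1+ n ]))

upper-generated : ∀ p q s → det (mat p q (+ 0) s) ≡ + 1 → Generated (mat p q (+ 0) s)
upper-generated p q s det≡1 with i*j≡1⇒i≡j≡±1 p s (trans (sym (det-upper p q s)) det≡1)
  where
  det-upper : ∀ p q s → p * s - q * + 0 ≡ p * s
  det-upper = solve-∀
... | inj₁ (refl , refl) = T^-generated q
... | inj₂ (refl , refl) = subst Generated (v-1·T^ q) (g-mul gen-v-1 (T^-generated (+ 1 - q)))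

infix 4 _⊏_
_⊏_ : M2 → M2 → Set
_⊏_ = ×-Lex _≡_ _<_ _<_ on λ γ → ∣ a γ ∣ , ∣ c γ ∣

⊏-wellFounded : WellFounded _⊏_
⊏-wellFounded = On.wellFounded _ (×-wellFounded <-wellFounded <-wellFounded)

a-v· : ∀ x γ → a (v x · γ) ≡ x * a γ + c γ
a-v· x γ = cong (_+_ (x * a γ)) (ℤP.*-identityˡ (c γ))

a-adj-v· : ∀ x γ → a (adj (v x) · γ) ≡ x * a γ - c γ
a-adj-v· x γ = cong (_+_ (x * a γ)) (ℤP.-1*i≡-i (c γ))

a-u· : ∀ s γ → a (u s · γ) ≡ a γ
a-u· s γ = ring-identity (a γ)
  where
  ring-identity : ∀ x → + 1 * x + + 0 ≡ x
  ring-identity = solve-∀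

a-adj-u· : ∀ s γ → a (adj (u s) · γ) ≡ a γ
a-adj-u· = a-u·

c-u· : ∀ s γ → c (u s · γ) ≡ c γ + + 8 * s * a γ
c-u· s γ = ring-identity (+ 8 * s) (a γ) (c γ)
  where
  ring-identity : ∀ k x y → k * x + + 1 * y ≡ y + k * x
  ring-identity = solve-∀

c-adj-u· : ∀ s γ → c (adj (u s) · γ) ≡ c γ - + 8 * s * a γ
c-adj-u· s γ = ring-identity (+ 8 * s) (a γ) (c γ)
  where
  ring-identity : ∀ k x y → - k * x + + 1 * y ≡ y - k * x
  ring-identity = solve-∀

v-step : ∀ x γ → ℕ.∣ ∣ x * a γ ∣ - ∣ c γ ∣ ∣ < ∣ a γ ∣ → v x · γ ⊏ γ ⊎ adj (v x) · γ ⊏ γ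
v-step x γ d<∣a∣ =
  Sum.map (smaller-a (v x · γ) (a-v· x γ)) (smaller-a (adj (v x) · γ) (a-adj-v· x γ))
          (∣x+y∣<⊎∣x-y∣< (x * a γ) (c γ) d<∣a∣)
  where
  smaller-a : ∀ δ {k} → a δ ≡ k → ∣ k ∣ < ∣ a γ ∣ → δ ⊏ γ
  smaller-a _ aδ≡k = inj₁ ∘ subst (_< ∣ a γ ∣) (cong ∣_∣ (sym aδ≡k))

u-step : ∀ s γ → ℕ.∣ ∣ c γ ∣ - ∣ + 8 * s * a γ ∣ ∣ < ∣ c γ ∣ → u s · γ ⊏ γ ⊎ adj (u s) · γ ⊏ γ
u-step s γ d<∣c∣ =
  Sum.map (same-a-smaller-c (u s · γ) (a-u· s γ) (c-u· s γ))
          (same-a-smaller-c (adj (u s) · γ) (a-adj-u· s γ) (c-adj-u· s γ))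
          (∣x+y∣<⊎∣x-y∣< (c γ) (+ 8 * s * a γ) d<∣c∣)
  where
  same-a-smaller-c : ∀ δ {k} → a δ ≡ a γ → c δ ≡ k → ∣ k ∣ < ∣ c γ ∣ → δ ⊏ γ
  same-a-smaller-c _ aδ≡aγ cδ≡k = inj₂ ∘ (cong ∣_∣ aδ≡aγ ,_) ∘ subst (_< ∣ c γ ∣) (cong ∣_∣ (sym cδ≡k))

Descent : M2 → Set
Descent γ = ∃[ δ ] δ ⊏ γ × InΓ₀8 δ × (Generated δ → Generated γ)

descend-by : ∀ {g} γ → Gen g → InΓ₀8 γ → g · γ ⊏ γ ⊎ adj g · γ ⊏ γ → Descent γ
descend-by {g} γ g∈ γ∈ (inj₁ gγ⊏γ) =
  g · γ , gγ⊏γ , Γ₀-· (+ 8) g γ (Gen⊆Γ₀8 g∈) γ∈ , Generated-cancelˡ g γ g∈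
descend-by {g} γ g∈ γ∈ (inj₂ g⁻¹γ⊏γ) =
  adj g · γ , g⁻¹γ⊏γ , Γ₀-· (+ 8) (adj g) γ (Γ₀-adj (+ 8) g (Gen⊆Γ₀8 g∈)) γ∈ , Generated-adj-cancelˡ g γ g∈

descent : ∀ γ → InΓ₀8 γ → c γ ≢ + 0 → Descent γ
descent γ γ∈ c≢0 with odd-descent (Γ₀8⇒a-odd γ γ∈) (proj₂ γ∈) (ℕP.n≢0⇒n>0 (c≢0 ∘ ℤP.∣i∣≡0⇒i≡0))
... | inj₁ d<∣a∣ = descend-by γ gen-v1 γ∈
  (v-step (+ 1) γ (subst (λ k → ℕ.∣ ∣ k ∣ - ∣ c γ ∣ ∣ < ∣ a γ ∣) (sym (ℤP.*-identityˡ (a γ))) d<∣a∣))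
... | inj₂ (inj₁ d<∣a∣) = descend-by γ gen-v3 γ∈
  (v-step (+ 3) γ (subst (λ k → ℕ.∣ k - ∣ c γ ∣ ∣ < ∣ a γ ∣) (sym (ℤP.abs-* (+ 3) (a γ))) d<∣a∣))
... | inj₂ (inj₂ d<∣c∣) = descend-by γ (gen-u (+ 1)) γ∈
  (u-step (+ 1) γ (subst (λ k → ℕ.∣ ∣ c γ ∣ - k ∣ < ∣ c γ ∣) (sym (ℤP.abs-* (+ 8) (a γ))) d<∣c∣))

Γ₀8⇒Generated : ∀ γ → InΓ₀8 γ → Generated γ
Γ₀8⇒Generated γ = go γ (⊏-wellFounded γ)
  where
  go : ∀ γ → Acc _⊏_ γ → InΓ₀8 γ → Generated γ
  go (mat p q r s) (acc smaller) γ∈ with r ℤ.≟ + 0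
  ... | yes refl = upper-generated p q s (proj₁ γ∈)
  ... | no r≢0 with descent (mat p q r s) γ∈ r≢0
  ...   | δ , δ⊏γ , δ∈ , from-δ = from-δ (go δ (smaller δ⊏γ) δ∈)

lemma6p2 : (γ : M2) → InΓ₀8 γ ⇔ Generated γ
lemma6p2 γ = mk⇔ (Γ₀8⇒Generated γ) Generated⇒Γ₀8
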